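{- Let $G$ be a full DAG, and suppose the edges of $G$ are labeled by elements of $\{1,2\}$ such that for every inner vertex $v$ the two edges of $\mathrm{in}(v)$ have distinct labels and the two edges of $\mathrm{out}(v)$ have distinct labels. Then $G$ has an ample framing $F$ whose exceptional routes are exactly the routes all of whose edges carry the same label (one for each edge leaving a source, obtained by following edges of that edge's label). Conversely, for every ample framing of $G$ there is such a labeling of the edges for which every exceptional route consists of edges with a constant label.
   Context: A DAG is a finite directed acyclic graph, possibly with multiple edges; sources have no incoming edges, sinks no outgoing edges, other vertices are inner; $\mathrm{in}(v),\mathrm{out}(v)$ are incoming/outgoing edges. $G$ is full if every inner vertex $v$ has $|\mathrm{in}(v)|=|\mathrm{out}(v)|=2$. A route is a maximal directed path (source to sink). A framing assigns to each inner vertex $v$ linear orders $\prec$ on $\mathrm{in}(v)$ and $\mathrm{out}(v)$. For inner $v$, paths in $\mathrm{Out}(v)$ (from $v$ to a sink) are compared by $P\prec Q$ iff at the last vertex $w$ of their common initial segment the edge of $P$ leaving $w$ precedes that of $Q$ in $\mathrm{out}(w)$; analogously for $\mathrm{In}(v)$ (paths from a source to $v$) at the first vertex of their common final segment using $\mathrm{in}(w)$. For a route $R$ through $v$, $Rv$, $vR$ are its parts before/after $v$. Routes $P,Q$ through a common inner vertex $v$ conflict at $v$ if, after possibly swapping them, $Pv\prec Qv$ and $vQ\prec vP$; coherent if no conflict at any common inner vertex. A route is exceptional if coherent with all routes. With $\mathcal{F}_+(G)\subset\mathbb{R}^{E(G)}$ the cone of nonnegative flows (conservation at inner vertices) and $v_R$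 the indicator vector of $R$, a framing is ample if $\{v_R:R\text{ exceptional}\}$ lies in no facet of $\mathcal{F}_+(G)$ (equivalently, every non-idle edge lies on an exceptional route; an edge is idle if it is the only incoming or only outgoing edge of an inner vertex). -}

module Defs where

open import Data.Nat using (ℕ)
open import Data.Fin using (Fin; _≟_)
open import Data.List using (List; []; _∷_; _++_; _∷ʳ_; filter; length; reverse)
open import Data.List.Membership.Propositional using (_∈_)
open import Data.Fin.Base using ()
open import Data.List using ()
open import Data.Product using (Σ; ∃; _×_; _,_)
open import Data.Sum using (_⊎_)
open import Data.Unit using (⊤)
open import Data.Empty using (⊥)
open import Relation.Nullary using (¬_)
open import Relation.Binary.PropositionalEquality using (_≡_; _≢_)
open import Data.List.Base using (allFin) public
open import Level using () renaming (suc to lsuc; zero to lzero)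

record Graph : Set where
  field
    nV  : ℕ
    nE  : ℕ
    src : Fin nE → Fin nV
    tgt : Fin nE → Fin nV

module _ (G : Graph) where
  open Graph G

  V = Fin nV
  E = Fin nE

  indeg : V → ℕ
  indeg v = length (filter (λ e → tgt e ≟ v) (allFin nE))

  outdeg : V → ℕ
  outdeg v = length (filter (λ e → src e ≟ v) (allFin nE))

  IsSource : V → Set
  IsSource v = indeg v ≡ 0

  IsSink : V → Set
  IsSink v = outdeg v ≡ 0

  IsInner : V → Set
  IsInner v = ¬ IsSource v × ¬ IsSink v

  Chain : List E → Set
  Chain []           = ⊤
  Chain (e ∷ [])     = ⊤
  Chain (e ∷ f ∷ P)  = tgt e ≡ src f × Chain (f ∷ P)

  StartsAt : List E → V → Set
  StartsAt []      v = ⊥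
  StartsAt (e ∷ _) v = src e ≡ v

  EndsAt : List E → V → Set
  EndsAt []          v = ⊥
  EndsAt (e ∷ [])    v = tgt e ≡ v
  EndsAt (e ∷ f ∷ P) v = EndsAt (f ∷ P) v

  IsAcyclic : Set
  IsAcyclic = ∀ (P : List E) (v : V) → ¬ (Chain P × StartsAt P v × EndsAt P v)

  IsFull : Set
  IsFull = ∀ v → IsInner v → indeg v ≡ 2 × outdeg v ≡ 2

  -- a route: maximal directed path, from a source to a sink
  IsRoute : List E → Set
  IsRoute R = Chain R × (∃ λ u → StartsAt R u × IsSource u)
                      × (∃ λ w → EndsAt R w × IsSink w)

  IsIdle : E → Set
  IsIdle e = (IsInner (tgt e) × indeg (tgt e) ≡ 1)
           ⊎ (IsInner (src e) × outdeg (src e) ≡ 1)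

  record Framing : Set₁ where
    field
      inLt  : V → E → E → Set
      outLt : V → E → E → Set
      in-irrefl  : ∀ v e → tgt e ≡ v → ¬ inLt v e e
      in-trans   : ∀ v e f g → tgt e ≡ v → tgt f ≡ v → tgt g ≡ v →
                   inLt v e f → inLt v f g → inLt v e g
      in-total   : ∀ v e f → IsInner v → tgt e ≡ v → tgt f ≡ v → e ≢ f →
                   inLt v e f ⊎ inLt v f e
      out-irrefl : ∀ v e → src e ≡ v → ¬ outLt v e e
      out-trans  : ∀ v e f g → src e ≡ v → src f ≡ v → src g ≡ v →
                   outLt v e f → outLt v f g → outLt v e g
      out-total  : ∀ v e f → IsInner v → src e ≡ v → src f ≡ v → e ≢ f →
                   outLt v e f ⊎ outLt v f e

  module _ (F : Framing) where
    open Framing F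

    -- order on Out(v): compare at the first edges where the paths diverge
    -- (they leave the last vertex w of the common initial segment)
    data OutPrec : List E → List E → Set where
      diverge : ∀ {e f P Q} → e ≢ f → outLt (src e) e f →
                OutPrec (e ∷ P) (f ∷ Q)
      common  : ∀ {e P Q} → OutPrec P Q → OutPrec (e ∷ P) (e ∷ Q)

    -- reversed comparison for In(v): lists given in reverse order,
    -- compare at the last edges (in path order) where they diverge,
    -- which enter the first vertex w of the common final segment
    data InPrecRev : List E → List E → Set where
      diverge : ∀ {e f P Q} → e ≢ f → inLt (tgt e) e f →
                InPrecRev (e ∷ P) (f ∷ Q)
      common  : ∀ {e P Q} → InPrecRev P Q → InPrecRev (e ∷ P) (e ∷ Q)

    InPrec : List E → List E → Set
    InPrec P Q = InPrecRev (reverse P) (reverse Q)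

    SplitAt : List E → V → List E → List E → Set
    SplitAt P v Pv vP = Σ (List E) λ P₁ → Σ E λ e →
      Pv ≡ P₁ ∷ʳ e × tgt e ≡ v × P ≡ Pv ++ vP

    ConflictAt : List E → List E → V → Set
    ConflictAt P Q v = IsInner v ×
      (Σ (List E) λ Pv → Σ (List E) λ vP → Σ (List E) λ Qv → Σ (List E) λ vQ →
        SplitAt P v Pv vP × SplitAt Q v Qv vQ ×
        ((InPrec Pv Qv × OutPrec vQ vP) ⊎ (InPrec Qv Pv × OutPrec vP vQ)))

    Coherent : List E → List E → Set
    Coherent P Q = ∀ v → ¬ ConflictAt P Q v

    IsExceptional : List E → Set
    IsExceptional R = IsRoute R × (∀ Q → IsRoute Q → Coherent R Q)

    -- ampleness, via its stated equivalent form: every non-idle edge lies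
    -- on an exceptional route
    IsAmple : Set
    IsAmple = ∀ e → ¬ IsIdle e → ∃ λ R → IsExceptional R × e ∈ R

  -- labellings by {1,2} (represented as Fin 2)
  IsProperLabelling : (E → Fin 2) → Set
  IsProperLabelling lab = ∀ v → IsInner v →
      (∀ e f → tgt e ≡ v → tgt f ≡ v → e ≢ f → lab e ≢ lab f)
    × (∀ e f → src e ≡ v → src f ≡ v → e ≢ f → lab e ≢ lab f)

  ConstantLabel : (E → Fin 2) → List E → Set
  ConstantLabel lab R = ∀ e f → e ∈ R → f ∈ R → lab e ≡ lab f

{-# OPTIONS --safe #-}
module Submission where

-- Both directions rest on one observation. Suppose the two in-edges and the two out-edges of
-- every inner vertex are ranked 0 and 1 in framing order. A route that enters v by an edge of
-- one rank and leaves by an edge of the other crosses the route through the two remaining edges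
-- at v, so exceptional routes keep their rank through every vertex. Likewise a route through
-- a, e, g with e ranked differently at its two ends crosses the route through the other in-edge
-- of src e, then e, then the other out-edge of tgt e. Such competing routes exist because in a
-- full acyclic graph every chain extends backwards to a source and forwards to a sink.
--
-- For a proper labelling, order in(v) and out(v) by label, so that the rank is the label:
-- exceptional routes have constant label, a constant route never meets another route in the
-- wrong order, and following one label from any edge yields an exceptional route through it.
-- For an ample framing, label each edge by its rank at its source (at its target if the source
-- is a source of G); since every edge lies on an exceptional route, this agrees with its rank
-- at the target, which makes the labelling proper and constant on exceptional routes.

open import Defs
open import Data.Fin using (Fin; zero; suc; _≟_)
open import Data.Fin.Properties using (0≢1+n)
open import Data.Fin.Induction using (spo-wellFounded; spo-noetherian)
open import Data.Nat using (ℕ) renaming (_≟_ to _≟ℕ_)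
open import Data.List using (List; []; _∷_; _++_; _∷ʳ_; reverse; filter; length; allFin; initLast; _∷ʳ′_)
open import Data.List.Properties using (∷ʳ-++; reverse-++)
open import Data.List.Relation.Unary.All as All using (All; []; _∷_)
open import Data.List.Relation.Unary.All.Properties using (++⁺)
open import Data.List.Relation.Unary.AllPairs using (_∷_)
open import Data.List.Relation.Unary.Any using (here; there)
open import Data.List.Relation.Unary.Any.Properties using (reverse⁻)
open import Data.List.Relation.Unary.Unique.Propositional using (Unique)
open import Data.List.Relation.Unary.Unique.Propositional.Properties using (filter⁺; allFin⁺)
open import Data.List.Membership.Propositional using (_∈_)
open import Data.List.Membership.Propositional.Properties
  using (∈-filter⁺; ∈-filter⁻; ∈-allFin; ∈-++⁺ˡ; ∈-++⁺ʳ; ∈-∃++)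
open import Data.Product using (Σ; ∃; ∃₂; _×_; _,_; proj₁; proj₂)
open import Data.Sum using (_⊎_; inj₁; inj₂; swap)
open import Data.Unit using (⊤; tt)
open import Data.Empty using (⊥-elim)
open import Function using (_∘_; flip)
open import Function.Bundles using (_⇔_; mk⇔)
open import Induction.WellFounded using (Acc; acc)
open import Relation.Binary.Structures using (IsStrictPartialOrder)
open import Relation.Binary.PropositionalEquality
open import Relation.Nullary using (¬_; Dec; yes; no)
open import Relation.Nullary.Decidable using (¬?; _×-dec_)

≢⇒01⊎10 : ∀ {a b : Fin 2} → a ≢ b → (a ≡ zero × b ≡ suc zero) ⊎ (b ≡ zero × a ≡ suc zero)
≢⇒01⊎10 {zero}     {zero}     a≢b = ⊥-elim (a≢b refl)
≢⇒01⊎10 {zero}     {suc zero} _   = inj₁ (refl , refl)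
≢⇒01⊎10 {suc zero} {zero}     _   = inj₂ (refl , refl)
≢⇒01⊎10 {suc zero} {suc zero} a≢b = ⊥-elim (a≢b refl)

≢⇒≡⊎≡ : ∀ {a b : Fin 2} c → a ≢ b → a ≡ c ⊎ b ≡ c
≢⇒≡⊎≡ c a≢b with ≢⇒01⊎10 a≢b | c
... | inj₁ (refl , refl) | zero     = inj₁ refl
... | inj₁ (refl , refl) | suc zero = inj₂ refl
... | inj₂ (refl , refl) | zero     = inj₂ refl
... | inj₂ (refl , refl) | suc zero = inj₁ refl

Ranked : ∀ {A : Set} → (A → A → Set) → (A → Fin 2) → A → A → Set
Ranked _<_ rank a b = rank a ≡ zero × rank b ≡ suc zero × a < b

Ranked-≢ : ∀ {A : Set} {_<_ : A → A → Set} {rank : A → Fin 2} {a b} →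
           Ranked _<_ rank a b ⊎ Ranked _<_ rank b a → rank a ≢ rank b
Ranked-≢ (inj₁ (a0 , b1 , _)) a≡b = 0≢1+n (trans (sym a0) (trans a≡b b1))
Ranked-≢ (inj₂ (b0 , a1 , _)) a≡b = 0≢1+n (trans (sym b0) (trans (sym a≡b) a1))

module _ {n : ℕ} where

  record Pair (P : Fin n → Set) : Set where
    field
      fst snd    : Fin n
      fst≢snd    : fst ≢ snd
      P-fst      : P fst
      P-snd      : P snd
      exhaustive : ∀ {e} → P e → e ≡ fst ⊎ e ≡ snd

  open Pair

  module _ {P : Fin n → Set} where

    Unique-length-2⇒Pair : ∀ xs → Unique xs → length xs ≡ 2 →
                           (∀ {e} → e ∈ xs → P e) → (∀ {e} → P e → e ∈ xs) → Pair P
    Unique-length-2⇒Pair (a ∷ b ∷ []) ((a≢b ∷ []) ∷ _) refl sound complete = record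
      { fst = a ; snd = b ; fst≢snd = a≢b
      ; P-fst = sound (here refl) ; P-snd = sound (there (here refl))
      ; exhaustive = λ pe → one-of-two (complete pe) }
      where
      one-of-two : ∀ {e} → e ∈ a ∷ b ∷ [] → e ≡ a ⊎ e ≡ b
      one-of-two (here e≡a)         = inj₁ e≡a
      one-of-two (there (here e≡b)) = inj₂ e≡b

    other : (p : Pair P) → ∀ {e} → P e → ∃ λ e′ → P e′ × e ≢ e′
    other p pe with exhaustive p pe
    ... | inj₁ refl = snd p , P-snd p , fst≢snd p
    ... | inj₂ refl = fst p , P-fst p , ≢-sym (fst≢snd p)

    has-label : (p : Pair P) (lab : Fin n → Fin 2) →
                (∀ e f → P e → P f → e ≢ f → lab e ≢ lab f) → ∀ c → ∃ λ e → P e × lab e ≡ c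
    has-label p lab distinct c with ≢⇒≡⊎≡ c (distinct _ _ (P-fst p) (P-snd p) (fst≢snd p))
    ... | inj₁ fst-c = fst p , P-fst p , fst-c
    ... | inj₂ snd-c = snd p , P-snd p , snd-c

    sort : {_<_ : Fin n → Fin n → Set} (p : Pair P) → fst p < snd p ⊎ snd p < fst p →
           Σ (Pair P) λ q → fst q < snd q
    sort p (inj₁ fst<snd) = p , fst<snd
    sort p (inj₂ snd<fst) = record
      { fst = snd p ; snd = fst p ; fst≢snd = ≢-sym (fst≢snd p)
      ; P-fst = P-snd p ; P-snd = P-fst p ; exhaustive = swap ∘ exhaustive p } , snd<fst

    rank : Pair P → Fin n → Fin 2
    rank p e with e ≟ fst p
    ... | yes _ = zero
    ... | no _  = suc zero

    rank-fst : (p : Pair P) → rank p (fst p) ≡ zero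
    rank-fst p with fst p ≟ fst p
    ... | yes _    = refl
    ... | no fst≢fst = ⊥-elim (fst≢fst refl)

    rank-snd : (p : Pair P) → rank p (snd p) ≡ suc zero
    rank-snd p with snd p ≟ fst p
    ... | yes snd≡fst = ⊥-elim (fst≢snd p (sym snd≡fst))
    ... | no _        = refl

    rank-ranked : {_<_ : Fin n → Fin n → Set} (p : Pair P) → fst p < snd p →
                  ∀ {e f} → P e → P f → e ≢ f → Ranked _<_ (rank p) e f ⊎ Ranked _<_ (rank p) f e
    rank-ranked p fst<snd pe pf e≢f with exhaustive p pe | exhaustive p pf
    ... | inj₁ refl | inj₁ refl = ⊥-elim (e≢f refl)
    ... | inj₁ refl | inj₂ refl = inj₁ (rank-fst p , rank-snd p , fst<snd)
    ... | inj₂ refl | inj₁ refl = inj₂ (rank-fst p , rank-snd p , fst<snd)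
    ... | inj₂ refl | inj₂ refl = ⊥-elim (e≢f refl)

open Pair

∈⇒length≢0 : ∀ {A : Set} {x : A} {xs} → x ∈ xs → length xs ≢ 0
∈⇒length≢0 (here _)  ()
∈⇒length≢0 (there _) ()

module _ (G : Graph) where
  open Graph G

  inner? : ∀ v → Dec (IsInner G v)
  inner? v = ¬? (indeg G v ≟ℕ 0) ×-dec ¬? (outdeg G v ≟ℕ 0)

  module _ (end : E G → V G) {v : V G} where

    ∈-incident : ∀ {e} → end e ≡ v → e ∈ filter (λ f → end f ≟ v) (allFin nE)
    ∈-incident {e} = ∈-filter⁺ (λ f → end f ≟ v) (∈-allFin e)

    incident⇒degree≢0 : ∀ {e} → end e ≡ v → length (filter (λ f → end f ≟ v) (allFin nE)) ≢ 0
    incident⇒degree≢0 = ∈⇒length≢0 ∘ ∈-incident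

    degree-2⇒Pair : length (filter (λ f → end f ≟ v) (allFin nE)) ≡ 2 → Pair (λ e → end e ≡ v)
    degree-2⇒Pair degree≡2 = Unique-length-2⇒Pair _ (filter⁺ (λ f → end f ≟ v) (allFin⁺ nE)) degree≡2
      (proj₂ ∘ ∈-filter⁻ (λ f → end f ≟ v) {xs = allFin nE}) ∈-incident

  inner-between : ∀ {x y v} → tgt x ≡ v → src y ≡ v → IsInner G v
  inner-between tx sy = incident⇒degree≢0 tgt tx , incident⇒degree≢0 src sy

  module _ (full : IsFull G) where

    inPair : ∀ {v} → IsInner G v → Pair (λ e → tgt e ≡ v)
    inPair {v} iv = degree-2⇒Pair tgt (proj₁ (full v iv))

    outPair : ∀ {v} → IsInner G v → Pair (λ e → src e ≡ v)
    outPair {v} iv = degree-2⇒Pair src (proj₂ (full v iv))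

    full⇒¬idle : ∀ e → ¬ IsIdle G e
    full⇒¬idle e (inj₁ (iv , indeg≡1)) with trans (sym (proj₁ (full _ iv))) indeg≡1
    ... | ()
    full⇒¬idle e (inj₂ (iv , outdeg≡1)) with trans (sym (proj₂ (full _ iv))) outdeg≡1
    ... | ()

  FromSource ToSink : List (E G) → Set
  FromSource L = ∃ λ u → StartsAt G L u × IsSource G u
  ToSink     L = ∃ λ w → EndsAt G L w × IsSink G w

  Chain-++ : ∀ x L {y M} → Chain G (x ∷ L) → EndsAt G (x ∷ L) (src y) → Chain G (y ∷ M) →
             Chain G (x ∷ L ++ y ∷ M)
  Chain-++ x []      _         xy chain = xy , chain
  Chain-++ x (z ∷ L) (xz , ch) end chain = xz , Chain-++ z L ch end chain

  Chain-++⁻ʳ : ∀ A {B} → Chain G (A ++ B) → Chain G B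
  Chain-++⁻ʳ []                   chain       = chain
  Chain-++⁻ʳ (a ∷ [])     {[]}    _           = tt
  Chain-++⁻ʳ (a ∷ [])     {b ∷ B} (_ , chain) = chain
  Chain-++⁻ʳ (a ∷ a′ ∷ A)         (_ , chain) = Chain-++⁻ʳ (a′ ∷ A) chain

  EndsAt-++⁺ : ∀ A {B w} → EndsAt G B w → EndsAt G (A ++ B) w
  EndsAt-++⁺ []                   end = end
  EndsAt-++⁺ (a ∷ [])     {b ∷ B} end = end
  EndsAt-++⁺ (a ∷ a′ ∷ A)         end = EndsAt-++⁺ (a′ ∷ A) end

  EndsAt-∷ʳ⁻ : ∀ A {e w} → EndsAt G (A ∷ʳ e) w → tgt e ≡ w
  EndsAt-∷ʳ⁻ []           end = end
  EndsAt-∷ʳ⁻ (a ∷ [])     end = end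
  EndsAt-∷ʳ⁻ (a ∷ a′ ∷ A) end = EndsAt-∷ʳ⁻ (a′ ∷ A) end

  route-has-predecessor : ∀ R1 {e R2} → IsRoute G (R1 ++ e ∷ R2) → ¬ IsSource G (src e) →
                          ∃₂ λ R1′ a → R1 ≡ R1′ ∷ʳ a
  route-has-predecessor R1 (_ , (_ , start , source) , _) ¬source with initLast R1
  ... | []        = ⊥-elim (¬source (subst (IsSource G) (sym start) source))
  ... | R1′ ∷ʳ′ a = R1′ , a , refl

  route-has-successor : ∀ R1 {e} R2 → IsRoute G (R1 ++ e ∷ R2) → ¬ IsSink G (tgt e) →
                        ∃₂ λ g R2′ → R2 ≡ g ∷ R2′
  route-has-successor R1 []       (_ , _ , (_ , end , sink)) ¬sink =
    ⊥-elim (¬sink (subst (IsSink G) (sym (EndsAt-∷ʳ⁻ R1 end)) sink))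
  route-has-successor R1 (g ∷ R2) _ _ = g , R2 , refl

  route-interior : ∀ {R e} → IsRoute G R → e ∈ R → IsInner G (src e) → IsInner G (tgt e) →
                   ∃₂ λ R1 a → ∃₂ λ g R2 → R ≡ R1 ++ a ∷ e ∷ g ∷ R2
  route-interior {e = e} route e∈R (¬source , _) (_ , ¬sink) with ∈-∃++ e∈R
  ... | R1 , R2 , refl
    with R1′ , a , refl ← route-has-predecessor R1 route ¬source
       | g , R2′ , refl ← route-has-successor R1 R2 route ¬sink
    = R1′ , a , g , R2′ , ∷ʳ-++ R1′ a (e ∷ g ∷ R2′)

  -- Extending chains to routes

  module _ (acyclic : IsAcyclic G) where

    _⊏_ : E G → E G → Set
    x ⊏ y = ∃ λ L → Chain G (x ∷ L) × EndsAt G (x ∷ L) (src y)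

    ⊏-isStrictPartialOrder : IsStrictPartialOrder _≡_ _⊏_
    ⊏-isStrictPartialOrder = record
      { isEquivalence = isEquivalence
      ; irrefl   = λ { {x} refl (L , chain , end) → acyclic (x ∷ L) (src x) (chain , refl , end) }
      ; trans    = λ { {x} {y} (L , chain , end) (M , chain′ , end′) →
                       L ++ y ∷ M , Chain-++ x L chain end chain′ , EndsAt-++⁺ (x ∷ L) end′ }
      ; <-resp-≈ = (λ { refl x⊏y → x⊏y }) , (λ { refl x⊏y → x⊏y }) }

    module _ (Good : E G → Set)
             (good-in  : ∀ {v} → IsInner G v → ∃ λ e → tgt e ≡ v × Good e)
             (good-out : ∀ {v} → IsInner G v → ∃ λ e → src e ≡ v × Good e) where

      walk-back : ∀ x T → Acc _⊏_ x → Good x → Chain G (x ∷ T) →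
                  ∃ λ P → All Good P × (Chain G (P ++ x ∷ T) × FromSource (P ++ x ∷ T))
      walk-back x T (acc smaller) good chain with indeg G (src x) ≟ℕ 0
      ... | yes source = [] , [] , chain , (src x , refl , source)
      ... | no ¬source
        with w , w-x , good-w ← good-in (¬source , incident⇒degree≢0 src refl)
        with P , good-P , walk ← walk-back w (x ∷ T) (smaller ([] , tt , w-x)) good-w (w-x , chain)
        = P ∷ʳ w , ++⁺ good-P (good-w ∷ []) ,
          subst (λ L → Chain G L × FromSource L) (sym (∷ʳ-++ P w (x ∷ T))) walk

      walk-forward : ∀ y → Acc (flip _⊏_) y → Good y →
                     ∃ λ S → All Good S × Chain G (y ∷ S) × ToSink (y ∷ S)
      walk-forward y (acc larger) good with outdeg G (tgt y) ≟ℕ 0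
      ... | yes sink = [] , [] , tt , (tgt y , refl , sink)
      ... | no ¬sink
        with z , z-y , good-z ← good-out (incident⇒degree≢0 tgt refl , ¬sink)
        with S , good-S , chain , to-sink ← walk-forward z (larger ([] , tt , sym z-y)) good-z
        = z ∷ S , good-z ∷ good-S , (sym z-y , chain) , to-sink

      extend-forward : ∀ x C → Chain G (x ∷ C) → All Good (x ∷ C) →
                       ∃ λ S → All Good S × Chain G (x ∷ C ++ S) × ToSink (x ∷ C ++ S)
      extend-forward x []      _          (good ∷ []) =
        walk-forward x (spo-noetherian ⊏-isStrictPartialOrder x) good
      extend-forward x (y ∷ C) (xy , chain) (_ ∷ good)
        with S , good-S , chain′ , to-sink ← extend-forward y C chain good
        = S , good-S , (xy , chain′) , to-sink

      extend-to-good-route : ∀ {x C} → Chain G (x ∷ C) → All Good (x ∷ C) →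
                             ∃₂ λ P S → IsRoute G (P ++ x ∷ C ++ S) × All Good (P ++ x ∷ C ++ S)
      extend-to-good-route {x} {C} chain good
        with S , good-S , chain′ , (w , end , sink) ← extend-forward x C chain good
        with P , good-P , chain″ , from-source ←
               walk-back x (C ++ S) (spo-wellFounded ⊏-isStrictPartialOrder x) (All.head good) chain′
        = P , S , (chain″ , from-source , (w , EndsAt-++⁺ P end , sink)) , ++⁺ good-P (++⁺ good good-S)

    module _ (full : IsFull G) where

      extend-to-route : ∀ {x C} → Chain G (x ∷ C) → ∃₂ λ P S → IsRoute G (P ++ x ∷ C ++ S)
      extend-to-route {x} {C} chain =
        let (P , S , route , _) =
              extend-to-good-route (λ _ → ⊤)
                (λ iv → fst (inPair full iv) , P-fst (inPair full iv) , tt)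
                (λ iv → fst (outPair full iv) , P-fst (outPair full iv) , tt)
                chain (All.universal (λ _ → tt) (x ∷ C))
        in P , S , route

  -- Conflicts and rankings

  module _ (F : Framing G) where
    open Framing F

    inPrec-at : ∀ {x x′ v P Q} → tgt x ≡ v → x ≢ x′ → inLt v x x′ → InPrecRev G F (x ∷ P) (x′ ∷ Q)
    inPrec-at refl = diverge

    outPrec-at : ∀ {y y′ v S S′} → src y ≡ v → y ≢ y′ → outLt v y y′ → OutPrec G F (y ∷ S) (y′ ∷ S′)
    outPrec-at refl = diverge

    OutPrec-common : ∀ C {S S′} → OutPrec G F S S′ → OutPrec G F (C ++ S) (C ++ S′)
    OutPrec-common []      S≺S′ = S≺S′
    OutPrec-common (c ∷ C) S≺S′ = common (OutPrec-common C S≺S′)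

    split-at : ∀ R1 {x T v} → tgt x ≡ v → SplitAt G F (R1 ++ x ∷ T) v (R1 ∷ʳ x) T
    split-at R1 {x} {T} tx = R1 , x , refl , tx , sym (∷ʳ-++ R1 x T)

    crossing : ∀ {R1 x T Q1 x′ T′ v} → IsInner G v → tgt x ≡ v → tgt x′ ≡ v → x ≢ x′ →
               inLt v x x′ → OutPrec G F T′ T → ConflictAt G F (R1 ++ x ∷ T) (Q1 ++ x′ ∷ T′) v
    crossing {R1} {x} {Q1 = Q1} {x′} iv tx tx′ x≢x′ x≺x′ T′≺T =
      iv , _ , _ , _ , _ , split-at R1 tx , split-at Q1 tx′ ,
      inj₁ (subst₂ (InPrecRev G F) (sym (reverse-++ R1 (x ∷ []))) (sym (reverse-++ Q1 (x′ ∷ [])))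
                   (inPrec-at tx x≢x′ x≺x′) ,
            T′≺T)

    ConflictAt-sym : ∀ {P Q v} → ConflictAt G F P Q v → ConflictAt G F Q P v
    ConflictAt-sym (iv , Pv , vP , Qv , vQ , split-P , split-Q , order) =
      iv , Qv , vQ , Pv , vP , split-Q , split-P , swap order

    InPrecRev-witness : ∀ {P Q} → InPrecRev G F P Q → ∃₂ λ e f → e ∈ P × f ∈ Q × inLt (tgt e) e f
    InPrecRev-witness (diverge _ e≺f) = _ , _ , here refl , here refl , e≺f
    InPrecRev-witness (common P≺Q) =
      let (e , f , e∈P , f∈Q , e≺f) = InPrecRev-witness P≺Q in e , f , there e∈P , there f∈Q , e≺f

    OutPrec-witness : ∀ {P Q} → OutPrec G F P Q → ∃₂ λ e f → e ∈ P × f ∈ Q × outLt (src e) e f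
    OutPrec-witness (diverge _ e≺f) = _ , _ , here refl , here refl , e≺f
    OutPrec-witness (common P≺Q) =
      let (e , f , e∈P , f∈Q , e≺f) = OutPrec-witness P≺Q in e , f , there e∈P , there f∈Q , e≺f

    SplitAt-∈ˡ : ∀ {R v Rv vR e} → SplitAt G F R v Rv vR → e ∈ reverse Rv → e ∈ R
    SplitAt-∈ˡ {Rv = Rv} (_ , _ , _ , _ , refl) = ∈-++⁺ˡ ∘ reverse⁻ {xs = Rv}

    SplitAt-∈ʳ : ∀ {R v Rv vR e} → SplitAt G F R v Rv vR → e ∈ vR → e ∈ R
    SplitAt-∈ʳ {Rv = Rv} (_ , _ , _ , _ , refl) = ∈-++⁺ʳ Rv

    record Ranking : Set where
      field
        inRank outRank : V G → E G → Fin 2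
        inRank-ranked  : ∀ {v e f} → IsInner G v → tgt e ≡ v → tgt f ≡ v → e ≢ f →
                         Ranked (inLt v) (inRank v) e f ⊎ Ranked (inLt v) (inRank v) f e
        outRank-ranked : ∀ {v e f} → IsInner G v → src e ≡ v → src f ≡ v → e ≢ f →
                         Ranked (outLt v) (outRank v) e f ⊎ Ranked (outLt v) (outRank v) f e

    module _ (ranking : Ranking) where
      open Ranking ranking

      inRank-injective : ∀ {v e f} → IsInner G v → tgt e ≡ v → tgt f ≡ v → e ≢ f → inRank v e ≢ inRank v f
      inRank-injective {v} iv ev fv e≢f = Ranked-≢ {_<_ = inLt v} (inRank-ranked iv ev fv e≢f)

      outRank-injective : ∀ {v e f} → IsInner G v → src e ≡ v → src f ≡ v → e ≢ f → outRank v e ≢ outRank v f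
      outRank-injective {v} iv ev fv e≢f = Ranked-≢ {_<_ = outLt v} (outRank-ranked iv ev fv e≢f)

      -- Were the ranks different, the two routes would enter v in one order and, after the
      -- common stretch C, leave w in the other order: a conflict at v.
      non-crossing⇒inRank≡outRank :
        ∀ {R1 x C y R2 Q1 x′ y′ Q2 v w} → IsInner G v → IsInner G w →
        tgt x ≡ v → tgt x′ ≡ v → x ≢ x′ → src y ≡ w → src y′ ≡ w → y ≢ y′ →
        ¬ ConflictAt G F (R1 ++ x ∷ C ++ y ∷ R2) (Q1 ++ x′ ∷ C ++ y′ ∷ Q2) v →
        inRank v x ≡ outRank w y
      non-crossing⇒inRank≡outRank {C = C} iv iw tx tx′ x≢x′ sy sy′ y≢y′ ¬conflict
        with inRank-ranked iv tx tx′ x≢x′ | outRank-ranked iw sy sy′ y≢y′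
      ... | inj₁ (x0 , _) | inj₁ (y0 , _) = trans x0 (sym y0)
      ... | inj₂ (_ , x1 , _) | inj₂ (_ , y1 , _) = trans x1 (sym y1)
      ... | inj₁ (_ , _ , x≺x′) | inj₂ (_ , _ , y′≺y) = ⊥-elim (¬conflict
            (crossing iv tx tx′ x≢x′ x≺x′ (OutPrec-common C (outPrec-at sy′ (≢-sym y≢y′) y′≺y))))
      ... | inj₂ (_ , _ , x′≺x) | inj₁ (_ , _ , y≺y′) = ⊥-elim (¬conflict (ConflictAt-sym
            (crossing iv tx′ tx (≢-sym x≢x′) x′≺x (OutPrec-common C (outPrec-at sy y≢y′ y≺y′)))))

      module _ (acyclic : IsAcyclic G) (full : IsFull G) where

        exceptional⇒inRank≡outRank : ∀ {R1 x y R2 v} → IsExceptional G F (R1 ++ x ∷ y ∷ R2) →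
                                     tgt x ≡ v → inRank v x ≡ outRank v y
        exceptional⇒inRank≡outRank {R1} {x} {y} {R2} ((chain , _) , coherent) refl =
          let (xy , _) = Chain-++⁻ʳ R1 chain
              iv = inner-between refl (sym xy)
              (x′ , tx′ , x≢x′) = other (inPair full iv) refl
              (y′ , sy′ , y≢y′) = other (outPair full iv) (sym xy)
              (Q1 , Q2 , route) = extend-to-route acyclic full {x′} {y′ ∷ []} (trans tx′ (sym sy′) , tt)
          in non-crossing⇒inRank≡outRank {C = []} {Q1 = Q1} {Q2 = Q2}
               iv iv refl tx′ x≢x′ (sym xy) sy′ y≢y′ (coherent _ route _)

        exceptional⇒outRank≡inRank : ∀ {R1 a e g R2} → IsExceptional G F (R1 ++ a ∷ e ∷ g ∷ R2) →
                                     outRank (src e) e ≡ inRank (tgt e) e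
        exceptional⇒outRank≡inRank {R1} {a} {e} {g} {R2} exceptional@((chain , _) , coherent) =
          let (ae , eg , _) = Chain-++⁻ʳ R1 chain
              iu = inner-between ae refl
              iw = inner-between refl (sym eg)
              (a′ , ta′ , a≢a′) = other (inPair full iu) ae
              (g′ , sg′ , g≢g′) = other (outPair full iw) (sym eg)
              (Q1 , Q2 , route) = extend-to-route acyclic full {a′} {e ∷ g′ ∷ []} (ta′ , sym sg′ , tt)
              exceptional′ = subst (IsExceptional G F) (sym (∷ʳ-++ R1 a (e ∷ g ∷ R2))) exceptional
          in begin
            outRank (src e) e ≡⟨ sym (exceptional⇒inRank≡outRank exceptional ae) ⟩
            inRank (src e) a  ≡⟨ non-crossing⇒inRank≡outRank {C = e ∷ []} {Q1 = Q1} {Q2 = Q2}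
                                   iu iw ae ta′ a≢a′ (sym eg) sg′ g≢g′ (coherent _ route _) ⟩
            outRank (tgt e) g ≡⟨ sym (exceptional⇒inRank≡outRank exceptional′ refl) ⟩
            inRank (tgt e) e  ∎
          where open ≡-Reasoning

  -- The framing of a proper labelling

  module _ (lab : E G → Fin 2) where

    all-equal⇒constant : ∀ {R c} → All (λ e → lab e ≡ c) R → ConstantLabel G lab R
    all-equal⇒constant all e f e∈R f∈R = trans (All.lookup all e∈R) (sym (All.lookup all f∈R))

    adjacent-equal⇒equal-to-head : ∀ x L → (∀ R1 y z R2 → x ∷ L ≡ R1 ++ y ∷ z ∷ R2 → lab y ≡ lab z) →
                                   All (λ e → lab e ≡ lab x) (x ∷ L)
    adjacent-equal⇒equal-to-head x []      _        = refl ∷ []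
    adjacent-equal⇒equal-to-head x (y ∷ L) adjacent =
      refl ∷ All.map (λ e-y → trans e-y (sym (adjacent [] x y L refl)))
                     (adjacent-equal⇒equal-to-head y L λ R1 z z′ R2 eq → adjacent (x ∷ R1) z z′ R2 (cong (x ∷_) eq))

    adjacent-equal⇒constant : ∀ R → (∀ R1 x y R2 → R ≡ R1 ++ x ∷ y ∷ R2 → lab x ≡ lab y) →
                              ConstantLabel G lab R
    adjacent-equal⇒constant []      _        _ _ ()
    adjacent-equal⇒constant (x ∷ L) adjacent = all-equal⇒constant (adjacent-equal⇒equal-to-head x L adjacent)

    constant-¬0∧1 : ∀ {R e f} → ConstantLabel G lab R → e ∈ R → f ∈ R → lab e ≡ zero → lab f ≢ suc zero
    constant-¬0∧1 constant e∈R f∈R e0 f1 = 0≢1+n (trans (sym e0) (trans (constant _ _ e∈R f∈R) f1))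

    module _ (proper : IsProperLabelling G lab) where

      LabelOrder : (E G → V G) → V G → E G → E G → Set
      LabelOrder end v e f = end e ≡ v × end f ≡ v × lab e ≡ zero × lab f ≡ suc zero

      LabelOrder-ranked : ∀ end {v e f} → end e ≡ v → end f ≡ v → lab e ≢ lab f →
                          Ranked (LabelOrder end v) lab e f ⊎ Ranked (LabelOrder end v) lab f e
      LabelOrder-ranked end ev fv le≢lf with ≢⇒01⊎10 le≢lf
      ... | inj₁ (e0 , f1) = inj₁ (e0 , f1 , ev , fv , e0 , f1)
      ... | inj₂ (f0 , e1) = inj₂ (f0 , e1 , fv , ev , f0 , e1)

      LabelOrder-total : ∀ end {v e f} → end e ≡ v → end f ≡ v → lab e ≢ lab f →
                         LabelOrder end v e f ⊎ LabelOrder end v f e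
      LabelOrder-total end ev fv le≢lf with LabelOrder-ranked end ev fv le≢lf
      ... | inj₁ (_ , _ , e<f) = inj₁ e<f
      ... | inj₂ (_ , _ , f<e) = inj₂ f<e

      labelFraming : Framing G
      labelFraming = record
        { inLt       = LabelOrder tgt
        ; outLt      = LabelOrder src
        ; in-irrefl  = λ { _ _ _ (_ , _ , e0 , e1) → 0≢1+n (trans (sym e0) e1) }
        ; in-trans   = λ { _ _ _ _ _ _ _ (e-v , _ , e0 , _) (_ , g-v , _ , g1) → e-v , g-v , e0 , g1 }
        ; in-total   = λ v e f iv ev fv e≢f → LabelOrder-total tgt ev fv (proj₁ (proper v iv) e f ev fv e≢f)
        ; out-irrefl = λ { _ _ _ (_ , _ , e0 , e1) → 0≢1+n (trans (sym e0) e1) }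
        ; out-trans  = λ { _ _ _ _ _ _ _ (e-v , _ , e0 , _) (_ , g-v , _ , g1) → e-v , g-v , e0 , g1 }
        ; out-total  = λ v e f iv ev fv e≢f → LabelOrder-total src ev fv (proj₂ (proper v iv) e f ev fv e≢f)
        }

      labelRanking : Ranking labelFraming
      labelRanking = record
        { inRank         = λ _ → lab
        ; outRank        = λ _ → lab
        ; inRank-ranked  = λ {v} iv ev fv e≢f → LabelOrder-ranked tgt ev fv (proj₁ (proper v iv) _ _ ev fv e≢f)
        ; outRank-ranked = λ {v} iv ev fv e≢f → LabelOrder-ranked src ev fv (proj₂ (proper v iv) _ _ ev fv e≢f)
        }

      constant⇒coherent : ∀ {R Q} → ConstantLabel G lab R → Coherent G labelFraming R Q
      constant⇒coherent constant v (_ , _ , _ , _ , _ , split , _ , inj₁ (Rv≺Qv , vQ≺vR)) =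
        let (e , _ , e∈Rv , _ , _ , _ , e0 , _) = InPrecRev-witness labelFraming Rv≺Qv
            (_ , f , _ , f∈vR , _ , _ , _ , f1) = OutPrec-witness labelFraming vQ≺vR
        in constant-¬0∧1 constant (SplitAt-∈ˡ labelFraming split e∈Rv) (SplitAt-∈ʳ labelFraming split f∈vR) e0 f1
      constant⇒coherent constant v (_ , _ , _ , _ , _ , split , _ , inj₂ (Qv≺Rv , vR≺vQ)) =
        let (_ , f , _ , f∈Rv , _ , _ , _ , f1) = InPrecRev-witness labelFraming Qv≺Rv
            (e , _ , e∈vR , _ , _ , _ , e0 , _) = OutPrec-witness labelFraming vR≺vQ
        in constant-¬0∧1 constant (SplitAt-∈ʳ labelFraming split e∈vR) (SplitAt-∈ˡ labelFraming split f∈Rv) e0 f1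

      constant⇒exceptional : ∀ {R} → IsRoute G R → ConstantLabel G lab R → IsExceptional G labelFraming R
      constant⇒exceptional route constant = route , λ _ _ → constant⇒coherent constant

      module _ (acyclic : IsAcyclic G) (full : IsFull G) where

        exceptional⇒constant : ∀ {R} → IsExceptional G labelFraming R → ConstantLabel G lab R
        exceptional⇒constant {R} exceptional = adjacent-equal⇒constant R λ R1 x y R2 R≡ →
          exceptional⇒inRank≡outRank labelFraming labelRanking acyclic full
            (subst (IsExceptional G labelFraming) R≡ exceptional) refl

        labelFraming-exceptional⇔constant :
          ∀ R → IsExceptional G labelFraming R ⇔ (IsRoute G R × ConstantLabel G lab R)
        labelFraming-exceptional⇔constant R =
          mk⇔ (λ exceptional → proj₁ exceptional , exceptional⇒constant exceptional)
              (λ (route , constant) → constant⇒exceptional route constant)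

        labelFraming-ample : IsAmple G labelFraming
        labelFraming-ample e _ =
          let (P , S , route , same-label) =
                extend-to-good-route acyclic (λ f → lab f ≡ lab e)
                  (λ {v} iv → has-label (inPair full iv) lab (proj₁ (proper v iv)) (lab e))
                  (λ {v} iv → has-label (outPair full iv) lab (proj₂ (proper v iv)) (lab e))
                  {e} {[]} tt (refl ∷ [])
          in P ++ e ∷ S , constant⇒exceptional route (all-equal⇒constant same-label) , ∈-++⁺ʳ P (here refl)

  -- The labelling of an ample framing

  module RankAt (end : E G → V G) (pair : ∀ {v} → IsInner G v → Pair (λ e → end e ≡ v))
                (_≺[_]_ : E G → V G → E G → Set)
                (total : ∀ v e f → IsInner G v → end e ≡ v → end f ≡ v → e ≢ f → e ≺[ v ] f ⊎ f ≺[ v ] e)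
                where

    sorted : ∀ {v} → IsInner G v → Σ (Pair (λ e → end e ≡ v)) λ p → fst p ≺[ v ] snd p
    sorted {v} iv = let p = pair iv in sort p (total v _ _ iv (P-fst p) (P-snd p) (fst≢snd p))

    -- The order is taken from the innerness proof computed by inner? v: in-total may order
    -- the pair differently for different proofs.
    rankAt : V G → E G → Fin 2
    rankAt v e with inner? v
    ... | yes iv = rank (proj₁ (sorted iv)) e
    ... | no _   = zero

    rankAt-ranked : ∀ {v e f} → IsInner G v → end e ≡ v → end f ≡ v → e ≢ f →
                    Ranked (_≺[ v ]_) (rankAt v) e f ⊎ Ranked (_≺[ v ]_) (rankAt v) f e
    rankAt-ranked {v} iv ev fv e≢f with inner? v
    ... | yes iv′ = rank-ranked (proj₁ (sorted iv′)) (proj₂ (sorted iv′)) ev fv e≢f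
    ... | no ¬iv  = ⊥-elim (¬iv iv)

  module _ (full : IsFull G) (F : Framing G) where
    open Framing F

    frameRanking : Ranking F
    frameRanking = record
      { inRank         = InRank.rankAt
      ; outRank        = OutRank.rankAt
      ; inRank-ranked  = InRank.rankAt-ranked
      ; outRank-ranked = OutRank.rankAt-ranked
      }
      where
      module InRank  = RankAt tgt (inPair full)  (λ e v f → inLt v e f)  in-total
      module OutRank = RankAt src (outPair full) (λ e v f → outLt v e f) out-total

    open Ranking frameRanking

    labelBy : ∀ e → Dec (IsInner G (src e)) → Fin 2
    labelBy e (yes _) = outRank (src e) e
    labelBy e (no _)  = inRank (tgt e) e

    rankLabel : E G → Fin 2
    rankLabel e = labelBy e (inner? (src e))

    rankLabel-out : ∀ {e v} → src e ≡ v → IsInner G v → rankLabel e ≡ outRank v e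
    rankLabel-out {e} refl iv = labelBy-inner (inner? (src e))
      where
      labelBy-inner : ∀ d → labelBy e d ≡ outRank (src e) e
      labelBy-inner (yes _)  = refl
      labelBy-inner (no ¬iv) = ⊥-elim (¬iv iv)

    module _ (acyclic : IsAcyclic G) (ample : IsAmple G F) where

      ample⇒outRank≡inRank : ∀ e → IsInner G (src e) → IsInner G (tgt e) → outRank (src e) e ≡ inRank (tgt e) e
      ample⇒outRank≡inRank e iu iw =
        let (R , exceptional , e∈R) = ample e (full⇒¬idle full e)
            (_ , _ , _ , _ , R≡) = route-interior (proj₁ exceptional) e∈R iu iw
        in exceptional⇒outRank≡inRank F frameRanking acyclic full
             (subst (IsExceptional G F) R≡ exceptional)

      rankLabel-in : ∀ {e v} → tgt e ≡ v → IsInner G v → rankLabel e ≡ inRank v e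
      rankLabel-in {e} refl iw = labelBy-inner (inner? (src e))
        where
        labelBy-inner : ∀ d → labelBy e d ≡ inRank (tgt e) e
        labelBy-inner (yes iu) = ample⇒outRank≡inRank e iu iw
        labelBy-inner (no _)   = refl

      rankLabel-proper : IsProperLabelling G rankLabel
      rankLabel-proper v iv =
        (λ e f ev fv e≢f eq → inRank-injective F frameRanking iv ev fv e≢f
           (trans (sym (rankLabel-in ev iv)) (trans eq (rankLabel-in fv iv)))) ,
        (λ e f ev fv e≢f eq → outRank-injective F frameRanking iv ev fv e≢f
           (trans (sym (rankLabel-out ev iv)) (trans eq (rankLabel-out fv iv))))

      exceptional⇒rankLabel-constant : ∀ {R} → IsExceptional G F R → ConstantLabel G rankLabel R
      exceptional⇒rankLabel-constant {R} exceptional = adjacent-equal⇒constant rankLabel R λ R1 x y R2 R≡ →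
        let exceptional′ = subst (IsExceptional G F) R≡ exceptional
            (xy , _) = Chain-++⁻ʳ R1 (proj₁ (proj₁ exceptional′))
            iv = inner-between refl (sym xy)
        in begin
          rankLabel x       ≡⟨ rankLabel-in refl iv ⟩
          inRank (tgt x) x  ≡⟨ exceptional⇒inRank≡outRank F frameRanking acyclic full exceptional′ refl ⟩
          outRank (tgt x) y ≡⟨ sym (rankLabel-out (sym xy) iv) ⟩
          rankLabel y       ∎
        where open ≡-Reasoning

corollary3p11 : (G : Graph) → IsAcyclic G → IsFull G →
    ((lab : Fin (Graph.nE G) → Fin 2) → IsProperLabelling G lab →
      Σ (Framing G) λ F → IsAmple G F ×
        ((R : List (Fin (Graph.nE G))) →
          IsExceptional G F R ⇔ (IsRoute G R × ConstantLabel G lab R)))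
    × ((F : Framing G) → IsAmple G F →
      Σ (Fin (Graph.nE G) → Fin 2) λ lab → IsProperLabelling G lab ×
        ((R : List (Fin (Graph.nE G))) → IsExceptional G F R → ConstantLabel G lab R))
corollary3p11 G acyclic full =
    (λ lab proper →
       labelFraming G lab proper ,
       labelFraming-ample G lab proper acyclic full ,
       labelFraming-exceptional⇔constant G lab proper acyclic full)
  , (λ F ample →
       rankLabel G full F ,
       rankLabel-proper G full F acyclic ample ,
       λ _ → exceptional⇒rankLabel-constant G full F acyclic ample)
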